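{- For every positive integer $n$, \[\chi(S_n)\le \chi(H_{n:2})\le \chi(S_n)+2.\]
   Context: For a positive integer $n$ write $[n]=\{1,\dots,n\}$. The Häggkvist–Hell graph $H_{n:2}$ is the graph whose vertices are the ordered pairs $(h,T)$ where $T$ is a $2$-element subset of $[n]$ and $h\in[n]\setminus T$; two vertices $(h_x,T_x)$ and $(h_y,T_y)$ are adjacent iff $h_x\in T_y$, $h_y\in T_x$ and $T_x\cap T_y=\varnothing$. The graph $S_n$ has as vertices the $3$-element subsets of $[n]$; two vertices $\{x_1,x_2,x_3\}$ ($x_1<x_2<x_3$) and $\{y_1,y_2,y_3\}$ ($y_1<y_2<y_3$) are adjacent iff either ($x_2=y_1$ and $x_3=y_2$) or ($y_2=x_1$ and $y_3=x_2$). $\chi$ denotes chromatic number. -}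

module Defs where

open import Level using (0ℓ)
open import Data.Nat using (ℕ; _≤_)
open import Data.Fin using (Fin) renaming (_<_ to _<ᶠ_)
open import Data.Product using (Σ; _×_)
open import Data.Sum using (_⊎_)
open import Relation.Binary.PropositionalEquality using (_≡_; _≢_)

record Graph : Set₁ where
  field
    V   : Set
    Adj : V → V → Set
open Graph public

ProperColouring : (G : Graph) (k : ℕ) → Set
ProperColouring G k =
  Σ (V G → Fin k) λ c → ∀ u v → Adj G u v → c u ≢ c v

Colourable : Graph → ℕ → Set
Colourable G k = ProperColouring G k

IsChromaticNumber : Graph → ℕ → Set
IsChromaticNumber G k = Colourable G k × (∀ j → Colourable G j → k ≤ j)

-- [n] is modelled by Fin n (element i ↦ i+1), with the usual order.

-- Vertices of S_n: 3-subsets {x1 < x2 < x3} of [n].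
record Triple (n : ℕ) : Set where
  constructor triple
  field
    x₁ x₂ x₃ : Fin n
    x₁<x₂ : x₁ <ᶠ x₂
    x₂<x₃ : x₂ <ᶠ x₃
open Triple public

SAdj : ∀ {n} → Triple n → Triple n → Set
SAdj x y = (x₂ x ≡ x₁ y × x₃ x ≡ x₂ y) ⊎ (x₂ y ≡ x₁ x × x₃ y ≡ x₂ x)

S : ℕ → Graph
S n = record { V = Triple n ; Adj = SAdj }

-- Vertices of H_{n:2}: pairs (h, T) with T = {t1 < t2} ⊆ [n] and h ∉ T.
record HVertex (n : ℕ) : Set where
  constructor hvertex
  field
    h t₁ t₂ : Fin n
    t₁<t₂ : t₁ <ᶠ t₂
    h≢t₁ : h ≢ t₁
    h≢t₂ : h ≢ t₂
open HVertex public

_∈T_ : ∀ {n} → Fin n → HVertex n → Set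
a ∈T y = a ≡ t₁ y ⊎ a ≡ t₂ y

Disjoint : ∀ {n} → HVertex n → HVertex n → Set
Disjoint x y = (t₁ x ≢ t₁ y) × (t₁ x ≢ t₂ y) × (t₂ x ≢ t₁ y) × (t₂ x ≢ t₂ y)

HAdj : ∀ {n} → HVertex n → HVertex n → Set
HAdj x y = (h x ∈T y) × (h y ∈T x) × Disjoint x y

H₂ : ℕ → Graph
H₂ n = record { V = HVertex n ; Adj = HAdj }

module Submission where

-- Lower bound.  The map (x₁ < x₂ < x₃) ↦ (x₂, {x₁, x₃}) is a graph
-- homomorphism S n → H_{n:2}, and chromatic number is monotone along
-- homomorphisms (pull a colouring back).
--
-- Upper bound.  Split the vertices (h, {t₁ < t₂}) of H_{n:2} into three
-- layers by the position of h: below t₁, between t₁ and t₂, above t₂.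
-- The bottom and the top layers are independent sets, and the middle layer
-- is a copy of S n: sending a middle vertex to the triple {t₁ < h < t₂}
-- maps adjacent vertices to adjacent triples.  So a proper colouring of
-- S n with a colours, plus one fresh colour per outer layer, is a proper
-- colouring of H_{n:2} with colours in Fin a ⊎ Fin 2 ≅ Fin (a + 2).

open import Defs
open import Data.Nat using (ℕ; _≤_; _+_; _<_)
import Data.Nat.Properties as ℕ
open import Data.Fin using (Fin; zero; suc; join; splitAt) renaming (_<_ to _<ᶠ_; _≤_ to _≤ᶠ_)
open import Data.Fin.Properties using (≤-refl; <-cmp; <-asym; <⇒≢; splitAt-join)
open import Data.Product using (Σ; _×_; _,_; proj₁; proj₂)
open import Data.Sum using (_⊎_; inj₁; inj₂)
open import Data.Sum.Properties using (inj₁-injective)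
open import Data.Empty using (⊥; ⊥-elim)
open import Function using (_∘_)
open import Function.Definitions using (Injective)
open import Relation.Binary.Definitions using (tri<; tri≈; tri>)
open import Relation.Binary.PropositionalEquality
  using (_≡_; _≢_; refl; sym; trans; cong; subst₂)

IsProper : (G : Graph) {C : Set} → (V G → C) → Set
IsProper G c = ∀ u v → Adj G u v → c u ≢ c v

recolour : (G : Graph) {C D : Set} (c : V G → C) (r : C → D) →
           Injective _≡_ _≡_ r → IsProper G c → IsProper G (r ∘ c)
recolour G c r r-inj proper u v adj = proper u v adj ∘ r-inj

join-injective : (a b : ℕ) → Injective _≡_ _≡_ (join a b)
join-injective a b {x} {y} e =
  trans (sym (splitAt-join a b x)) (trans (cong (splitAt a) e) (splitAt-join a b y))

sumColouring : (G : Graph) {a b : ℕ} (c : V G → Fin a ⊎ Fin b) →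
               IsProper G c → ProperColouring G (a + b)
sumColouring G {a} {b} c proper =
  join a b ∘ c , recolour G c (join a b) (join-injective a b) proper

Homomorphism : Graph → Graph → Set
Homomorphism G H = Σ (V G → V H) λ f → ∀ u v → Adj G u v → Adj H (f u) (f v)

pullback : {G H : Graph} {k : ℕ} →
           Homomorphism G H → ProperColouring H k → ProperColouring G k
pullback (f , f-hom) (c , proper) =
  c ∘ f , λ u v adj → proper (f u) (f v) (f-hom u v adj)

χ-monotone : {G H : Graph} {a b : ℕ} → Homomorphism G H →
             IsChromaticNumber G a → IsChromaticNumber H b → a ≤ b
χ-monotone φ (_ , minimalG) (colourableH , _) = minimalG _ (pullback φ colourableH)

module _ {n : ℕ} where

  >⇒≢ : {i j : Fin n} → j <ᶠ i → i ≢ j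
  >⇒≢ j<i = <⇒≢ j<i ∘ sym

  embed : Triple n → HVertex n
  embed (triple x₁ x₂ x₃ p q) =
    hvertex x₂ x₁ x₃ (ℕ.<-trans p q) (>⇒≢ p) (<⇒≢ q)

  -- If x₂ x = x₁ y and x₃ x = x₂ y then the heads of the images lie in each
  -- other's pairs, and the pairs {x₁ x, x₃ x} and {x₁ y, x₃ y} are disjoint
  -- because x₁ x < x₁ y < x₃ x < x₃ y.
  embed-shifted : (x y : Triple n) → x₂ x ≡ x₁ y → x₃ x ≡ x₂ y →
                  HAdj (embed x) (embed y)
  embed-shifted (triple _ _ _ p q) (triple _ _ _ p′ q′) refl refl =
    inj₁ refl , inj₂ refl ,
    <⇒≢ p , <⇒≢ (ℕ.<-trans p (ℕ.<-trans q q′)) , >⇒≢ q , <⇒≢ q′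

  HAdj-sym : {u v : HVertex n} → HAdj u v → HAdj v u
  HAdj-sym (hv∈u , hu∈v , d₁₁ , d₁₂ , d₂₁ , d₂₂) =
    hu∈v , hv∈u , d₁₁ ∘ sym , d₂₁ ∘ sym , d₁₂ ∘ sym , d₂₂ ∘ sym

  embed-homomorphism : Homomorphism (S n) (H₂ n)
  embed-homomorphism = embed , preserves
    where
    preserves : ∀ x y → SAdj x y → HAdj (embed x) (embed y)
    preserves x y (inj₁ (e₂ , e₃)) = embed-shifted x y e₂ e₃
    preserves x y (inj₂ (e₂ , e₃)) = HAdj-sym {embed y} {embed x} (embed-shifted y x e₂ e₃)

  data Layer (v : HVertex n) : Set where
    below  : h v <ᶠ t₁ v → Layer v
    middle : t₁ v <ᶠ h v → h v <ᶠ t₂ v → Layer v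
    above  : t₂ v <ᶠ h v → Layer v

  layer : (v : HVertex n) → Layer v
  layer v with <-cmp (h v) (t₁ v)
  ... | tri< h<t₁ _ _ = below h<t₁
  ... | tri≈ _ h≡t₁ _ = ⊥-elim (h≢t₁ v h≡t₁)
  ... | tri> _ _ t₁<h with <-cmp (h v) (t₂ v)
  ...   | tri< h<t₂ _ _ = middle t₁<h h<t₂
  ...   | tri≈ _ h≡t₂ _ = ⊥-elim (h≢t₂ v h≡t₂)
  ...   | tri> _ _ t₂<h = above t₂<h

  ∈T⇒t₁≤ : {x : Fin n} (v : HVertex n) → x ∈T v → t₁ v ≤ᶠ x
  ∈T⇒t₁≤ v (inj₁ refl) = ≤-refl
  ∈T⇒t₁≤ v (inj₂ refl) = ℕ.<⇒≤ (t₁<t₂ v)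

  ∈T⇒≤t₂ : {x : Fin n} (v : HVertex n) → x ∈T v → x ≤ᶠ t₂ v
  ∈T⇒≤t₂ v (inj₁ refl) = ℕ.<⇒≤ (t₁<t₂ v)
  ∈T⇒≤t₂ v (inj₂ refl) = ≤-refl

  -- The bottom layer is independent: adjacency would give
  -- h u < t₁ u ≤ h v < t₁ v ≤ h u.
  below-independent : {u v : HVertex n} → HAdj u v →
                      h u <ᶠ t₁ u → h v <ᶠ t₁ v → ⊥
  below-independent {u} {v} (hu∈v , hv∈u , _) hu<t₁u hv<t₁v =
    ℕ.<-asym (ℕ.<-≤-trans hu<t₁u (∈T⇒t₁≤ u hv∈u))
             (ℕ.<-≤-trans hv<t₁v (∈T⇒t₁≤ v hu∈v))

  -- Dually, the top layer is independent: h u ≤ t₂ v < h v ≤ t₂ u < h u.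
  above-independent : {u v : HVertex n} → HAdj u v →
                      t₂ u <ᶠ h u → t₂ v <ᶠ h v → ⊥
  above-independent {u} {v} (hu∈v , hv∈u , _) t₂u<hu t₂v<hv =
    ℕ.<-asym (ℕ.≤-<-trans (∈T⇒≤t₂ v hu∈v) t₂v<hv)
             (ℕ.≤-<-trans (∈T⇒≤t₂ u hv∈u) t₂u<hu)

  middleTriple : (v : HVertex n) → t₁ v <ᶠ h v → h v <ᶠ t₂ v → Triple n
  middleTriple v = triple (t₁ v) (h v) (t₂ v)

  -- Adjacent middle vertices give adjacent triples: each head is the
  -- smaller element of the other pair or the larger one; the two "same
  -- side" cases are circular, the two mixed ones are exactly S-adjacency.
  middle-adjacent : {u v : HVertex n} → HAdj u v →
                    (pu : t₁ u <ᶠ h u) (qu : h u <ᶠ t₂ u)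
                    (pv : t₁ v <ᶠ h v) (qv : h v <ᶠ t₂ v) →
                    SAdj (middleTriple u pu qu) (middleTriple v pv qv)
  middle-adjacent (inj₁ hu≡t₁v , inj₁ hv≡t₁u , _) pu qu pv qv =
    ⊥-elim (<-asym pu (subst₂ _<ᶠ_ (sym hu≡t₁v) hv≡t₁u pv))
  middle-adjacent (inj₂ hu≡t₂v , inj₂ hv≡t₂u , _) pu qu pv qv =
    ⊥-elim (<-asym qu (subst₂ _<ᶠ_ hv≡t₂u (sym hu≡t₂v) qv))
  middle-adjacent (inj₁ hu≡t₁v , inj₂ hv≡t₂u , _) _ _ _ _ = inj₁ (hu≡t₁v , sym hv≡t₂u)
  middle-adjacent (inj₂ hu≡t₂v , inj₁ hv≡t₁u , _) _ _ _ _ = inj₂ (hv≡t₁u , sym hu≡t₂v)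

  layerColour : {a : ℕ} → (Triple n → Fin a) → {v : HVertex n} → Layer v → Fin a ⊎ Fin 2
  layerColour c (below _) = inj₂ zero
  layerColour c {v} (middle p q) = inj₁ (c (middleTriple v p q))
  layerColour c (above _) = inj₂ (suc zero)

  layerColour-proper : {a : ℕ} (c : Triple n → Fin a) → IsProper (S n) c →
                       {u v : HVertex n} → HAdj u v → (lu : Layer u) (lv : Layer v) →
                       layerColour c lu ≢ layerColour c lv
  layerColour-proper c _ {u} {v} adj (below p) (below p′) _ = below-independent {u} {v} adj p p′
  layerColour-proper c _ {u} {v} adj (above p) (above p′) _ = above-independent {u} {v} adj p p′
  layerColour-proper c c-proper {u} {v} adj (middle pu qu) (middle pv qv) =
    c-proper _ _ (middle-adjacent {u} {v} adj pu qu pv qv) ∘ inj₁-injective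
  layerColour-proper c _ _ (below _)    (middle _ _) ()
  layerColour-proper c _ _ (below _)    (above _)    ()
  layerColour-proper c _ _ (middle _ _) (below _)    ()
  layerColour-proper c _ _ (middle _ _) (above _)    ()
  layerColour-proper c _ _ (above _)    (below _)    ()
  layerColour-proper c _ _ (above _)    (middle _ _) ()

  colourH₂ : {a : ℕ} → ProperColouring (S n) a → ProperColouring (H₂ n) (a + 2)
  colourH₂ (c , c-proper) =
    sumColouring (H₂ n) (layerColour c ∘ layer)
      λ u v adj → layerColour-proper c c-proper adj (layer u) (layer v)

mainTheorem19 : (n : ℕ) → 0 < n → (a b : ℕ) →
    IsChromaticNumber (S n) a → IsChromaticNumber (H₂ n) b →
    a ≤ b × b ≤ a + 2
mainTheorem19 n _ a b χS χH =
  χ-monotone embed-homomorphism χS χH ,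
  proj₂ χH (a + 2) (colourH₂ (proj₁ χS))
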